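{- Let $T,S\subseteq\mathbb{Z}_{>0}$ be finite with $T\preceq S$, and let $x\in T$ be such that $T\setminus\{x\}\preceq S$. Then $(T\triangleleft S)(i)\ge((T\setminus\{x\})\triangleleft S)(i)$ for all $i\in[|S|]$.
   Context: For finite $T,S\subseteq\mathbb{Z}_{>0}$, $T\triangleleft S$ is computed by going through $s\in S$ from largest to smallest; each $s$ picks the largest not-yet-picked $t\in T$ with $t<s$, if one exists; $T\triangleleft S$ is the set of picked elements. $S(i)$ denotes the $i$-th smallest element of $S$. $T\preceq S$ means $|T|\ge|S|$ and $T(i)<S(i)$ for all $i\in[|S|]$. -}

module Defs where

open import Data.Nat using (ℕ; zero; suc; _<_; _≤_; _<?_; _≟_; _⊔_)
open import Data.Maybe using (Maybe; just; nothing)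
open import Data.List using (List; []; _∷_; length; reverse; filter)
open import Data.List.Relation.Unary.All using (All)
open import Data.List.Relation.Unary.AllPairs using (AllPairs)
open import Data.List.Membership.DecPropositional _≟_ using (_∈?_)
open import Data.Product using (Σ; _×_)
open import Relation.Binary.PropositionalEquality using (_≡_)
open import Relation.Nullary using (yes; no; ¬_)

-- A finite subset of ℤ_{>0} is represented by the list of its elements in
-- strictly increasing order, all positive.
IsPosFinSet : List ℕ → Set
IsPosFinSet T = AllPairs _<_ T × All (λ n → 0 < n) T

-- S(i) (0-based index i; the paper's S(i+1)): i-th smallest element.
_!_ : List ℕ → ℕ → Maybe ℕ
[] ! _ = nothing
(x ∷ xs) ! zero = just x
(x ∷ xs) ! suc i = xs ! i

_⪯_ : List ℕ → List ℕ → Set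
T ⪯ S = length S ≤ length T
      × (∀ i → i < length S → Σ ℕ λ a → Σ ℕ λ b → T ! i ≡ just a × S ! i ≡ just b × a < b)

remove : ℕ → List ℕ → List ℕ
remove x [] = []
remove x (y ∷ ys) with x ≟ y
... | yes _ = remove x ys
... | no _ = y ∷ remove x ys

largestBelow : ℕ → List ℕ → Maybe ℕ
largestBelow s [] = nothing
largestBelow s (t ∷ ts) with t <? s | largestBelow s ts
... | yes _ | nothing = just t
... | yes _ | just u = just (t ⊔ u)
... | no _ | r = r

pickAll : List ℕ → List ℕ → List ℕ
pickAll [] avail = []
pickAll (s ∷ ss) avail with largestBelow s avail
... | nothing = pickAll ss avail
... | just t = t ∷ pickAll ss (remove t avail)

-- T ◁ S : S traversed from largest to smallest (S is increasing, so reverse);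
-- the result is returned as a subset of T in increasing order.
_◁_ : List ℕ → List ℕ → List ℕ
T ◁ S = filter (_∈? pickAll (reverse S) T) T

{-# OPTIONS --safe #-}
module Submission where

-- Run the greedy pass of S over T and over T ∖ {x} side by side.  They pick the same element at
-- each step until the pass over T picks x; the pass over T ∖ {x}, which picks at every step
-- because T ∖ {x} ⪯ S, then takes a smaller x', and from there on the two pools differ exactly
-- in x'.  Hence the set picked from T ∖ {x} arises from the one picked from T by replacing x with
-- a smaller element that was not picked (or equals it), and such a replacement can only lower
-- every order statistic.

open import Defs
open import Data.Nat using (ℕ; zero; suc; _<_; _≤_; _≮_; _≟_; _<?_; _⊔_; z≤n; s≤s; s≤s⁻¹)
open import Data.Nat.Properties
open import Data.Maybe using (Maybe; just; nothing)
open import Data.List using (List; []; _∷_; length; reverse; filter; _∷ʳ_)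
open import Data.List.Properties using (unfold-reverse; length-reverse; reverse-involutive; filter-reject)
open import Data.List.Relation.Unary.Any using (here; there) renaming (tail to ∈-tail)
open import Data.List.Relation.Unary.All using (All; []; _∷_; lookup; tabulate)
open import Data.List.Relation.Unary.AllPairs using (AllPairs; []; _∷_)
import Data.List.Relation.Unary.AllPairs.Properties as AllPairs
open import Data.List.Membership.DecPropositional _≟_ using (_∈?_)
open import Data.List.Membership.Propositional.Properties using (∈-filter⁺)
open import Data.List.Relation.Unary.Unique.Propositional using (Unique)
open import Data.List.Membership.Propositional using (_∈_; _∉_)
open import Data.List.Relation.Binary.Subset.Propositional using (_⊆_)
open import Data.Product using (Σ; ∃; _×_; _,_; proj₁; proj₂) renaming (map₂ to ×-map₂)
open import Data.Sum using (_⊎_; inj₁; inj₂; [_,_]′) renaming (map₁ to ⊎-map₁; map₂ to ⊎-map₂)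
open import Data.Empty using (⊥-elim)
open import Function using (_∘_)
open import Function.Bundles using (_⇔_; mk⇔; Equivalence)
open import Relation.Nullary using (¬_; yes; no)
open import Relation.Unary using (Decidable)
open import Relation.Binary.PropositionalEquality using (_≡_; _≢_; refl; sym; trans; cong; subst; subst₂; ≢-sym)

Increasing : List ℕ → Set
Increasing = AllPairs _<_

!-∈ : ∀ L i {u} → L ! i ≡ just u → u ∈ L
!-∈ (x ∷ L) zero refl = here refl
!-∈ (x ∷ L) (suc i) e = there (!-∈ L i e)

Increasing-!-< : ∀ {L} → Increasing L → ∀ i j {u v} → L ! i ≡ just u → L ! j ≡ just v → i < j → u < v
Increasing-!-< (x<L ∷ _) zero (suc j) refl e _ = lookup x<L (!-∈ _ j e)
Increasing-!-< (_ ∷ inc) (suc i) (suc j) eᵢ eⱼ (s≤s i<j) = Increasing-!-< inc i j eᵢ eⱼ i<j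

length-∷ʳ : ∀ (S : List ℕ) s → length (S ∷ʳ s) ≡ suc (length S)
length-∷ʳ [] s = refl
length-∷ʳ (x ∷ S) s = cong suc (length-∷ʳ S s)

length<length-∷ʳ : ∀ (S : List ℕ) s → length S < length (S ∷ʳ s)
length<length-∷ʳ S s = subst (length S <_) (sym (length-∷ʳ S s)) ≤-refl

∷ʳ-!-last : ∀ (S : List ℕ) s → (S ∷ʳ s) ! length S ≡ just s
∷ʳ-!-last [] s = refl
∷ʳ-!-last (x ∷ S) s = ∷ʳ-!-last S s

∷ʳ-!-init : ∀ (S : List ℕ) s i → i < length S → (S ∷ʳ s) ! i ≡ S ! i
∷ʳ-!-init (x ∷ S) s zero _ = refl
∷ʳ-!-init (x ∷ S) s (suc i) (s≤s i<S) = ∷ʳ-!-init S s i i<S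

∈-remove⁻ : ∀ {z t} L → z ∈ remove t L → z ∈ L × z ≢ t
∈-remove⁻ {t = t} (u ∷ us) z∈ with t ≟ u
∈-remove⁻ (u ∷ us) z∈ | yes _ = let z∈us , z≢t = ∈-remove⁻ us z∈ in there z∈us , z≢t
∈-remove⁻ (u ∷ us) (here refl) | no t≢u = here refl , ≢-sym t≢u
∈-remove⁻ (u ∷ us) (there z∈) | no _ = let z∈us , z≢t = ∈-remove⁻ us z∈ in there z∈us , z≢t

∈-remove⁺ : ∀ {z t} L → z ∈ L → z ≢ t → z ∈ remove t L
∈-remove⁺ {t = t} (u ∷ us) z∈ z≢t with t ≟ u
∈-remove⁺ (u ∷ us) (here refl) z≢t | yes t≡u = ⊥-elim (z≢t (sym t≡u))
∈-remove⁺ (u ∷ us) (there z∈) z≢t | yes _ = ∈-remove⁺ us z∈ z≢t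
∈-remove⁺ (u ∷ us) (here refl) z≢t | no _ = here refl
∈-remove⁺ (u ∷ us) (there z∈) z≢t | no _ = there (∈-remove⁺ us z∈ z≢t)

∉-remove : ∀ t L → t ∉ remove t L
∉-remove t L t∈ = proj₂ (∈-remove⁻ L t∈) refl

All-remove : ∀ {P : ℕ → Set} t {L} → All P L → All P (remove t L)
All-remove t [] = []
All-remove t {u ∷ us} (pu ∷ pus) with t ≟ u
... | yes _ = All-remove t pus
... | no _ = pu ∷ All-remove t pus

Increasing-remove : ∀ t {L} → Increasing L → Increasing (remove t L)
Increasing-remove t [] = []
Increasing-remove t {u ∷ us} (u<us ∷ inc) with t ≟ u
... | yes _ = Increasing-remove t inc
... | no _ = All-remove t u<us ∷ Increasing-remove t inc

remove-∉ : ∀ t L → t ∉ L → remove t L ≡ L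
remove-∉ t [] _ = refl
remove-∉ t (u ∷ us) t∉ with t ≟ u
... | yes t≡u = ⊥-elim (t∉ (here t≡u))
... | no _ = cong (u ∷_) (remove-∉ t us (λ t∈ → t∉ (there t∈)))

length-remove : ∀ t {L} → Increasing L → t ∈ L → length L ≡ suc (length (remove t L))
length-remove t {u ∷ us} (u<us ∷ inc) t∈ with t ≟ u
length-remove t {u ∷ us} (u<us ∷ inc) t∈ | yes refl =
  cong (λ L → suc (length L)) (sym (remove-∉ t us (λ t∈us → <-irrefl refl (lookup u<us t∈us))))
length-remove t (_ ∷ _) (here t≡u) | no t≢u = ⊥-elim (t≢u t≡u)
length-remove t (_ ∷ inc) (there t∈) | no _ = cong suc (length-remove t inc t∈)

remove-!-below : ∀ t {L} → Increasing L → ∀ i {u} → L ! i ≡ just u → u < t → remove t L ! i ≡ just u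
remove-!-below t {v ∷ vs} inc i e u<t with t ≟ v
remove-!-below t (v<vs ∷ _) zero refl u<t | yes refl = ⊥-elim (<-irrefl refl u<t)
remove-!-below t (v<vs ∷ _) (suc i) e u<t | yes refl = ⊥-elim (<-asym u<t (lookup v<vs (!-∈ _ i e)))
remove-!-below t inc zero e u<t | no _ = e
remove-!-below t (_ ∷ inc) (suc i) e u<t | no _ = remove-!-below t inc i e u<t

remove-head : ∀ u us → remove u (u ∷ us) ≡ remove u us
remove-head u us with u ≟ u
... | yes _ = refl
... | no u≢u = ⊥-elim (u≢u refl)

remove-∷ : ∀ {t u} us → t ≢ u → remove t (u ∷ us) ≡ u ∷ remove t us
remove-∷ {t} {u} us t≢u with t ≟ u
... | yes t≡u = ⊥-elim (t≢u t≡u)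
... | no _ = refl

remove-comm : ∀ x y L → remove x (remove y L) ≡ remove y (remove x L)
remove-comm x y [] = refl
remove-comm x y (u ∷ us) with x ≟ u | y ≟ u
... | yes refl | yes refl = refl
... | yes refl | no _ = trans (remove-head x (remove y us)) (remove-comm x y us)
... | no _ | yes refl = trans (remove-comm x y us) (sym (remove-head y (remove x us)))
... | no x≢u | no y≢u =
  trans (remove-∷ (remove y us) x≢u) (trans (cong (u ∷_) (remove-comm x y us)) (sym (remove-∷ (remove x us) y≢u)))

Unique-⊆-length≤ : ∀ {P F} → Unique P → P ⊆ F → Increasing F → length P ≤ length F
Unique-⊆-length≤ {[]} _ _ _ = z≤n
Unique-⊆-length≤ {p ∷ ps} {F} (p∉ps ∷ uniq) ⊆F incF = begin
  suc (length ps)               ≤⟨ s≤s (Unique-⊆-length≤ uniq ps⊆ (Increasing-remove p incF)) ⟩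
  suc (length (remove p F))     ≡⟨ length-remove p incF (⊆F (here refl)) ⟨
  length F                      ∎
  where
  open ≤-Reasoning
  ps⊆ : ps ⊆ remove p F
  ps⊆ z∈ = ∈-remove⁺ F (⊆F (there z∈)) (≢-sym (lookup p∉ps z∈))

data _≤*_ : List ℕ → List ℕ → Set where
  []ˡ : ∀ {A} → [] ≤* A
  []ʳ : ∀ {B} → B ≤* []
  _∷_ : ∀ {b a B A} → b ≤ a → B ≤* A → (b ∷ B) ≤* (a ∷ A)

≤*-refl : ∀ L → L ≤* L
≤*-refl [] = []ˡ
≤*-refl (x ∷ L) = ≤-refl ∷ ≤*-refl L

≤*-lookup : ∀ {B A} → B ≤* A → ∀ i → i < length A → i < length B →
  Σ ℕ λ a → Σ ℕ λ b → A ! i ≡ just a × B ! i ≡ just b × b ≤ a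
≤*-lookup []ˡ i _ ()
≤*-lookup []ʳ i () _
≤*-lookup (b≤a ∷ _) zero _ _ = _ , _ , refl , refl , b≤a
≤*-lookup (_ ∷ B≤*A) (suc i) (s≤s i<A) (s≤s i<B) = ≤*-lookup B≤*A i i<A i<B

module _ {P Q : ℕ → Set} (P? : Decidable P) (Q? : Decidable Q) where

  filter-cong-∈ : ∀ L → (∀ {z} → z ∈ L → Q z ⇔ P z) → filter Q? L ≡ filter P? L
  filter-cong-∈ [] _ = refl
  filter-cong-∈ (u ∷ us) Q⇔P with Q? u | P? u
  ... | yes _ | yes _ = cong (u ∷_) (filter-cong-∈ us (λ z∈ → Q⇔P (there z∈)))
  ... | no _ | no _ = filter-cong-∈ us (λ z∈ → Q⇔P (there z∈))
  ... | yes qu | no ¬pu = ⊥-elim (¬pu (Equivalence.to (Q⇔P (here refl)) qu))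
  ... | no ¬qu | yes pu = ⊥-elim (¬qu (Equivalence.from (Q⇔P (here refl)) pu))

  ∷-filter-≤* : ∀ {x} y ts → Increasing ts → All (y <_) ts → y ≤ x → x ∈ ts → P x → ¬ Q x →
    (∀ {z} → z ∈ ts → z ≢ x → Q z ⇔ P z) → (y ∷ filter Q? ts) ≤* filter P? ts
  ∷-filter-≤* {x} y (u ∷ us) (u<us ∷ inc) (y<u ∷ y<us) y≤x x∈ px ¬qx Q⇔P with u ≟ x | Q? u | P? u
  ... | yes refl | yes qx | _ = ⊥-elim (¬qx qx)
  ... | yes refl | no _ | no ¬px = ⊥-elim (¬px px)
  ... | yes refl | no _ | yes _ =
    y≤x ∷ subst (_≤* filter P? us) (sym (filter-cong-∈ us Q⇔P-us)) (≤*-refl (filter P? us))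
    where
    Q⇔P-us : ∀ {z} → z ∈ us → Q z ⇔ P z
    Q⇔P-us z∈ = Q⇔P (there z∈) (>⇒≢ (lookup u<us z∈))
  ... | no u≢x | yes _ | yes _ =
    <⇒≤ y<u ∷ ∷-filter-≤* u us inc u<us (<⇒≤ (lookup u<us x∈us)) x∈us px ¬qx (λ z∈ → Q⇔P (there z∈))
    where x∈us = ∈-tail (≢-sym u≢x) x∈
  ... | no u≢x | no _ | no _ =
    ∷-filter-≤* y us inc y<us y≤x (∈-tail (≢-sym u≢x) x∈) px ¬qx (λ z∈ → Q⇔P (there z∈))
  ... | no u≢x | yes qu | no ¬pu = ⊥-elim (¬pu (Equivalence.to (Q⇔P (here refl) u≢x) qu))
  ... | no u≢x | no ¬qu | yes pu = ⊥-elim (¬qu (Equivalence.from (Q⇔P (here refl) u≢x) pu))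

  filter-∷-≤* : ∀ t ts → Q t ⇔ P t → filter Q? ts ≤* filter P? ts → filter Q? (t ∷ ts) ≤* filter P? (t ∷ ts)
  filter-∷-≤* t ts Qt⇔Pt ts≤* with Q? t | P? t
  ... | yes _ | yes _ = ≤-refl ∷ ts≤*
  ... | no _ | no _ = ts≤*
  ... | yes qt | no ¬pt = ⊥-elim (¬pt (Equivalence.to Qt⇔Pt qt))
  ... | no ¬qt | yes pt = ⊥-elim (¬qt (Equivalence.from Qt⇔Pt pt))

  filter-exchange-≤* : ∀ {n x} T → Increasing T → n ∈ T → n < x → x ∈ T → Q n → ¬ P n → P x → ¬ Q x →
    (∀ {z} → z ≢ n → z ≢ x → Q z ⇔ P z) → filter Q? T ≤* filter P? T
  filter-exchange-≤* {n} (t ∷ ts) (t<ts ∷ inc) n∈ n<x x∈ qn ¬pn px ¬qx Q⇔P with t ≟ n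
  ... | no t≢n =
    filter-∷-≤* t ts (Q⇔P t≢n (<⇒≢ t<x))
      (filter-exchange-≤* ts inc n∈ts n<x (∈-tail (>⇒≢ t<x) x∈) qn ¬pn px ¬qx Q⇔P)
    where
    n∈ts = ∈-tail (≢-sym t≢n) n∈
    t<x = <-trans (lookup t<ts n∈ts) n<x
  ... | yes refl with Q? t | P? t
  ...   | no ¬qn | _ = ⊥-elim (¬qn qn)
  ...   | _ | yes pn = ⊥-elim (¬pn pn)
  ...   | yes _ | no _ =
    ∷-filter-≤* t ts inc t<ts (<⇒≤ n<x) (∈-tail (>⇒≢ n<x) x∈) px ¬qx (λ z∈ → Q⇔P (>⇒≢ (lookup t<ts z∈)))

filter-remove : ∀ {Q : ℕ → Set} (Q? : Decidable Q) x L → ¬ Q x → filter Q? (remove x L) ≡ filter Q? L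
filter-remove Q? x [] _ = refl
filter-remove Q? x (u ∷ us) ¬qx with x ≟ u
... | yes refl = trans (filter-remove Q? x us ¬qx) (sym (filter-reject Q? ¬qx))
... | no _ with Q? u
...   | yes _ = cong (u ∷_) (filter-remove Q? x us ¬qx)
...   | no _ = filter-remove Q? x us ¬qx

data LargestBelow (s : ℕ) (L : List ℕ) : Maybe ℕ → Set where
  none : (∀ {u} → u ∈ L → u ≮ s) → LargestBelow s L nothing
  some : ∀ {t} → t ∈ L → t < s → (∀ {u} → u ∈ L → u < s → u ≤ t) → LargestBelow s L (just t)

largestBelow-spec : ∀ s L → LargestBelow s L (largestBelow s L)
largestBelow-spec s [] = none λ ()
largestBelow-spec s (t ∷ ts) with t <? s | largestBelow s ts | largestBelow-spec s ts
... | yes t<s | nothing | none ts≮s = some (here refl) t<s max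
  where
  max : ∀ {u} → u ∈ t ∷ ts → u < s → u ≤ t
  max (here refl) _ = ≤-refl
  max (there u∈) u<s = ⊥-elim (ts≮s u∈ u<s)
... | yes t<s | just v | some v∈ v<s vmax = some t⊔v∈ (⊔-pres-<m t<s v<s) max
  where
  t⊔v∈ : t ⊔ v ∈ t ∷ ts
  t⊔v∈ = [ here , (λ e → there (subst (_∈ ts) (sym e) v∈)) ]′ (⊔-sel t v)
  max : ∀ {u} → u ∈ t ∷ ts → u < s → u ≤ t ⊔ v
  max (here refl) _ = m≤m⊔n t v
  max (there u∈) u<s = ≤-trans (vmax u∈ u<s) (m≤n⊔m t v)
... | no t≮s | _ | none ts≮s = none λ { (here refl) → t≮s ; (there u∈) → ts≮s u∈ }
... | no t≮s | _ | some v∈ v<s vmax = some (there v∈) v<s max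
  where
  max : ∀ {u} → u ∈ t ∷ ts → u < s → u ≤ _
  max (here refl) u<s = ⊥-elim (t≮s u<s)
  max (there u∈) u<s = vmax u∈ u<s

pickAll-⊆ : ∀ ss A → pickAll ss A ⊆ A
pickAll-⊆ (s ∷ ss) A z∈ with largestBelow s A | largestBelow-spec s A
pickAll-⊆ (s ∷ ss) A z∈ | nothing | _ = pickAll-⊆ ss A z∈
pickAll-⊆ (s ∷ ss) A (here refl) | just t | some t∈ _ _ = t∈
pickAll-⊆ (s ∷ ss) A (there z∈) | just t | _ = proj₁ (∈-remove⁻ A (pickAll-⊆ ss (remove t A) z∈))

pickAll-length≤ : ∀ ss A → length (pickAll ss A) ≤ length ss
pickAll-length≤ [] A = ≤-refl
pickAll-length≤ (s ∷ ss) A with largestBelow s A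
... | nothing = m≤n⇒m≤1+n (pickAll-length≤ ss A)
... | just t = s≤s (pickAll-length≤ ss (remove t A))

pickAll-Unique : ∀ ss A → Unique (pickAll ss A)
pickAll-Unique [] A = []
pickAll-Unique (s ∷ ss) A with largestBelow s A
... | nothing = pickAll-Unique ss A
... | just t = tabulate t≢ ∷ pickAll-Unique ss (remove t A)
  where
  t≢ : ∀ {z} → z ∈ pickAll ss (remove t A) → t ≢ z
  t≢ z∈ t≡z = ∉-remove t A (subst (_∈ remove t A) (sym t≡z) (pickAll-⊆ ss (remove t A) z∈))

⪯-∷ʳ-last : ∀ A S s → A ⪯ (S ∷ʳ s) → ∃ λ a → A ! length S ≡ just a × a < s
⪯-∷ʳ-last A S s (_ , below) with below (length S) (length<length-∷ʳ S s)
... | a , b , eₐ , e_b , a<b with trans (sym (∷ʳ-!-last S s)) e_b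
...   | refl = a , eₐ , a<b

-- t ≥ A(|S|) since A(|S|) < s, so removing t leaves A(0), …, A(|S| − 1) in place.
⪯-∷ʳ-remove : ∀ A {t} S s → Increasing A → A ⪯ (S ∷ʳ s) → t ∈ A → (∀ {u} → u ∈ A → u < s → u ≤ t) →
  remove t A ⪯ S
⪯-∷ʳ-remove A {t} S s inc A⪯ t∈ max = length≤ , below
  where
  length≤ : length S ≤ length (remove t A)
  length≤ = s≤s⁻¹ (subst₂ _≤_ (length-∷ʳ S s) (length-remove t inc t∈) (proj₁ A⪯))
  below : ∀ i → i < length S → Σ ℕ λ a → Σ ℕ λ b → remove t A ! i ≡ just a × S ! i ≡ just b × a < b
  below i i<S with proj₂ A⪯ i (<-trans i<S (length<length-∷ʳ S s)) | ⪯-∷ʳ-last A S s A⪯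
  ... | a , b , eₐ , e_b , a<b | aₗ , eₗ , aₗ<s =
    a , b ,
    remove-!-below t inc i eₐ (<-≤-trans (Increasing-!-< inc i (length S) eₐ eₗ i<S) (max (!-∈ A _ eₗ) aₗ<s)) ,
    trans (sym (∷ʳ-!-init S s i i<S)) e_b , a<b

length-pickAll : ∀ R A → Increasing A → A ⪯ reverse R → length (pickAll R A) ≡ length R
length-pickAll [] A _ _ = refl
length-pickAll (s ∷ R) A inc A⪯
  with largestBelow s A | largestBelow-spec s A | subst (A ⪯_) (unfold-reverse s R) A⪯
... | nothing | none A≮s | A⪯ʳ =
  let a , eₐ , a<s = ⪯-∷ʳ-last A (reverse R) s A⪯ʳ in ⊥-elim (A≮s (!-∈ A _ eₐ) a<s)
... | just t | some t∈ _ max | A⪯ʳ =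
  cong suc (length-pickAll R (remove t A) (Increasing-remove t inc) (⪯-∷ʳ-remove A (reverse R) s inc A⪯ʳ t∈ max))

record ExchangedBelow (A : List ℕ) (y : ℕ) (P P' : List ℕ) : Set where
  field
    new : ℕ
    new∈A : new ∈ A
    new∉P : new ∉ P
    new≡y⊎new<y : new ≡ y ⊎ (new < y × y ∈ P)
    ∈P'⁻ : ∀ {z} → z ∈ P' → (z ∈ P ⊎ z ≡ new) × z ≢ y
    ∈P'⁺ : ∀ {z} → (z ∈ P ⊎ z ≡ new) × z ≢ y → z ∈ P'

  y∉P' : y ∉ P'
  y∉P' y∈P' = proj₂ (∈P'⁻ y∈P') refl

  ∈P'⇒∈P : ∀ {z} → z ∈ P' → z ≢ new → z ∈ P
  ∈P'⇒∈P z∈P' z≢new = [ (λ z∈P → z∈P) , (λ z≡new → ⊥-elim (z≢new z≡new)) ]′ (proj₁ (∈P'⁻ z∈P'))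

ExchangedBelow-∷ : ∀ {A y a P P'} → a ∈ A → a ≢ y →
  ExchangedBelow (remove a A) y P P' → ExchangedBelow A y (a ∷ P) (a ∷ P')
ExchangedBelow-∷ {A} {y} {a} {P} {P'} a∈ a≢y E = record
  { new = new
  ; new∈A = proj₁ (∈-remove⁻ A new∈A)
  ; new∉P = λ { (here new≡a) → proj₂ (∈-remove⁻ A new∈A) new≡a ; (there new∈) → new∉P new∈ }
  ; new≡y⊎new<y = ⊎-map₂ (×-map₂ there) new≡y⊎new<y
  ; ∈P'⁻ = to
  ; ∈P'⁺ = from
  }
  where
  open ExchangedBelow E
  to : ∀ {z} → z ∈ a ∷ P' → (z ∈ a ∷ P ⊎ z ≡ new) × z ≢ y
  to (here refl) = inj₁ (here refl) , a≢y
  to (there z∈) with ∈P'⁻ z∈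
  ... | inj₁ z∈P , z≢y = inj₁ (there z∈P) , z≢y
  ... | inj₂ z≡new , z≢y = inj₂ z≡new , z≢y
  from : ∀ {z} → (z ∈ a ∷ P ⊎ z ≡ new) × z ≢ y → z ∈ a ∷ P'
  from (inj₁ (here refl) , _) = here refl
  from (inj₁ (there z∈P) , z≢y) = there (∈P'⁺ (inj₁ z∈P , z≢y))
  from (inj₂ z≡new , z≢y) = there (∈P'⁺ (inj₂ z≡new , z≢y))

ExchangedBelow-pick : ∀ {A y a' P P'} → a' < y → P ⊆ remove y A →
  ExchangedBelow (remove y A) a' P P' → ExchangedBelow A y (y ∷ P) (a' ∷ P')
ExchangedBelow-pick {A} {y} {a'} {P} {P'} a'<y P⊆ E = record
  { new = new
  ; new∈A = proj₁ (∈-remove⁻ A new∈A)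
  ; new∉P = λ { (here new≡y) → new≢y new≡y ; (there new∈) → new∉P new∈ }
  ; new≡y⊎new<y = inj₂ (new<y , here refl)
  ; ∈P'⁻ = to
  ; ∈P'⁺ = from
  }
  where
  open ExchangedBelow E
  new≢y : new ≢ y
  new≢y = proj₂ (∈-remove⁻ A new∈A)
  new<y : new < y
  new<y = [ (λ { refl → a'<y }) , (λ (new<a' , _) → <-trans new<a' a'<y) ]′ new≡y⊎new<y
  a'∈P⊎a'≡new : a' ∈ P ⊎ a' ≡ new
  a'∈P⊎a'≡new = [ (λ new≡a' → inj₂ (sym new≡a')) , (λ (_ , a'∈P) → inj₁ a'∈P) ]′ new≡y⊎new<y
  to : ∀ {z} → z ∈ a' ∷ P' → (z ∈ y ∷ P ⊎ z ≡ new) × z ≢ y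
  to (here refl) = ⊎-map₁ there a'∈P⊎a'≡new , <⇒≢ a'<y
  to (there z∈) with ∈P'⁻ z∈
  ... | inj₁ z∈P , _ = inj₁ (there z∈P) , proj₂ (∈-remove⁻ A (P⊆ z∈P))
  ... | inj₂ refl , _ = inj₂ refl , new≢y
  from : ∀ {z} → (z ∈ y ∷ P ⊎ z ≡ new) × z ≢ y → z ∈ a' ∷ P'
  from {z} (z∈ , z≢y) with z ≟ a'
  ... | yes refl = here refl
  ... | no z≢a' = there (∈P'⁺ (⊎-map₁ (drop-y z≢y) z∈ , z≢a'))
    where
    drop-y : z ≢ y → z ∈ y ∷ P → z ∈ P
    drop-y z≢y (here z≡y) = ⊥-elim (z≢y z≡y)
    drop-y _ (there z∈P) = z∈P

pickAll-remove-exchanged : ∀ ss A y → y ∈ A → length (pickAll ss (remove y A)) ≡ length ss →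
  ExchangedBelow A y (pickAll ss A) (pickAll ss (remove y A))
pickAll-remove-exchanged [] A y y∈A _ = record
  { new = y ; new∈A = y∈A ; new∉P = λ () ; new≡y⊎new<y = inj₁ refl
  ; ∈P'⁻ = λ () ; ∈P'⁺ = λ { (inj₁ () , _) ; (inj₂ refl , z≢y) → ⊥-elim (z≢y refl) }
  }
pickAll-remove-exchanged (s ∷ ss) A y y∈A all-pick
  with largestBelow s (remove y A) | largestBelow-spec s (remove y A)
... | nothing | _ = ⊥-elim (<-irrefl refl (subst (_≤ length ss) all-pick (pickAll-length≤ ss (remove y A))))
... | just a' | some a'∈ a'<s a'-max with largestBelow s A | largestBelow-spec s A
...   | nothing | none A≮s = ⊥-elim (A≮s (proj₁ (∈-remove⁻ A a'∈)) a'<s)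
...   | just a | some a∈ a<s a-max with a ≟ y
...     | yes refl = ExchangedBelow-pick a'<a (pickAll-⊆ ss (remove a A))
                       (pickAll-remove-exchanged ss (remove a A) a' a'∈ (suc-injective all-pick))
  where
  a'<a : a' < a
  a'<a = ≤∧≢⇒< (a-max (proj₁ (∈-remove⁻ A a'∈)) a'<s) (proj₂ (∈-remove⁻ A a'∈))
...     | no a≢y with ≤-antisym (a'-max (∈-remove⁺ A a∈ a≢y) a<s) (a-max (proj₁ (∈-remove⁻ A a'∈)) a'<s)
...       | refl =
  ExchangedBelow-∷ a∈ a≢y (subst (ExchangedBelow (remove a A) y (pickAll ss (remove a A)) ∘ pickAll ss) comm IH)
  where
  comm = remove-comm y a A
  IH = pickAll-remove-exchanged ss (remove a A) y (∈-remove⁺ A y∈A (≢-sym a≢y))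
         (trans (cong (length ∘ pickAll ss) comm) (suc-injective all-pick))

⪯-reverse-involutive : ∀ A S → A ⪯ S → A ⪯ reverse (reverse S)
⪯-reverse-involutive A S = subst (A ⪯_) (sym (reverse-involutive S))

◁-length : ∀ {T} S → Increasing T → T ⪯ S → length S ≤ length (T ◁ S)
◁-length {T} S inc T⪯S = begin
  length S                      ≡⟨ length-reverse S ⟨
  length (reverse S)            ≡⟨ length-pickAll (reverse S) T inc (⪯-reverse-involutive T S T⪯S) ⟨
  length P                      ≤⟨ Unique-⊆-length≤ (pickAll-Unique (reverse S) T) P⊆T◁S T◁S-Increasing ⟩
  length (T ◁ S)                ∎
  where
  open ≤-Reasoning
  P = pickAll (reverse S) T
  P⊆T◁S : P ⊆ T ◁ S
  P⊆T◁S z∈ = ∈-filter⁺ (_∈? P) (pickAll-⊆ (reverse S) T z∈) z∈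
  T◁S-Increasing : Increasing (T ◁ S)
  T◁S-Increasing = AllPairs.filter⁺ (_∈? P) inc

ExchangedBelow-filter-≤* : ∀ {T x P P'} → Increasing T → x ∈ T → ExchangedBelow T x P P' →
  filter (_∈? P') T ≤* filter (_∈? P) T
ExchangedBelow-filter-≤* {T} {x} {P} {P'} inc x∈T E with ExchangedBelow.new≡y⊎new<y E
... | inj₁ new≡x =
  subst (_≤* filter (_∈? P) T) (sym (filter-cong-∈ (_∈? P) (_∈? P') T λ _ → P'⇔P)) (≤*-refl _)
  where
  open ExchangedBelow E
  P'⇔P : ∀ {z} → z ∈ P' ⇔ z ∈ P
  P'⇔P = mk⇔ (λ z∈P' → ∈P'⇒∈P z∈P' (λ z≡new → proj₂ (∈P'⁻ z∈P') (trans z≡new new≡x)))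
             (λ z∈P → ∈P'⁺ (inj₁ z∈P , λ z≡x → new∉P (subst (_∈ P) (trans z≡x (sym new≡x)) z∈P)))
... | inj₂ (new<x , x∈P) =
  filter-exchange-≤* (_∈? P) (_∈? P') T inc new∈A new<x x∈T (∈P'⁺ (inj₂ refl , <⇒≢ new<x)) new∉P x∈P y∉P'
    λ z≢new z≢x → mk⇔ (λ z∈P' → ∈P'⇒∈P z∈P' z≢new) (λ z∈P → ∈P'⁺ (inj₁ z∈P , z≢x))
  where open ExchangedBelow E

◁-remove-≤* : ∀ {T} S {x} → Increasing T → x ∈ T → remove x T ⪯ S → (remove x T ◁ S) ≤* (T ◁ S)
◁-remove-≤* {T} S {x} inc x∈T T'⪯S =
  subst (_≤* (T ◁ S)) (sym (filter-remove (_∈? P') x T (ExchangedBelow.y∉P' E)))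
    (ExchangedBelow-filter-≤* inc x∈T E)
  where
  P' = pickAll (reverse S) (remove x T)
  E = pickAll-remove-exchanged (reverse S) T x x∈T
        (length-pickAll (reverse S) (remove x T) (Increasing-remove x inc) (⪯-reverse-involutive (remove x T) S T'⪯S))

lemma4p11 : (T S : List ℕ) → IsPosFinSet T → IsPosFinSet S → T ⪯ S →
    (x : ℕ) → x ∈ T → remove x T ⪯ S →
    ∀ i → i < length S →
      Σ ℕ λ a → Σ ℕ λ b → (T ◁ S) ! i ≡ just a × (remove x T ◁ S) ! i ≡ just b × b ≤ a
lemma4p11 T S (inc , _) _ T⪯S x x∈T T'⪯S i i<S =
  ≤*-lookup (◁-remove-≤* S inc x∈T T'⪯S) i
    (<-≤-trans i<S (◁-length S inc T⪯S))
    (<-≤-trans i<S (◁-length S (Increasing-remove x inc) T'⪯S))
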